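{- Let $b\geq3$ and $t\geq0$ be integers. Let $T$ be a tree with exactly $b$ leaves and diameter at most $4t+3$. Then the maximum matching number of $T$ is at most $bt+2$.
   Context: Leaves are vertices of degree $1$; the diameter is the maximum distance between two vertices; the maximum matching number is the largest number of pairwise vertex-disjoint edges. -}

module Defs where

open import Data.Nat using (ℕ; zero; suc; _+_; _*_; _≤_; _≥_)
open import Data.Fin using (Fin)
open import Data.Bool using (Bool; true; false; T)
open import Data.List using (List; []; _∷_; length; filter; map)
open import Data.List.Relation.Unary.Unique.Propositional using (Unique)
open import Data.List.Relation.Unary.AllPairs using (AllPairs)
open import Data.Vec.Functional using (Vector)
open import Data.Fin.Subset using (Subset; ∣_∣)
open import Data.Vec using (tabulate)
open import Data.Product using (Σ; _×_; ∃; ∃-syntax; _,_)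
open import Relation.Binary.PropositionalEquality using (_≡_; _≢_)
open import Relation.Nullary using (¬_)
open import Data.Empty using (⊥)
open import Data.Unit using (⊤)

record Graph (n : ℕ) : Set where
  field
    adj   : Fin n → Fin n → Bool
    sym   : ∀ u v → adj u v ≡ adj v u
    irrefl : ∀ v → adj v v ≡ false

open Graph public

module _ {n : ℕ} (G : Graph n) where

  Adj : Fin n → Fin n → Set
  Adj u v = T (adj G u v)

  data Walk : Fin n → Fin n → ℕ → Set where
    here : ∀ {u} → Walk u u 0
    step : ∀ {u w v k} → Adj u w → Walk w v k → Walk u v (suc k)

  Chain : List (Fin n) → Set
  Chain []           = ⊤
  Chain (x ∷ [])     = ⊤
  Chain (x ∷ y ∷ xs) = Adj x y × Chain (y ∷ xs)

  last : Fin n → List (Fin n) → Fin n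
  last x []       = x
  last x (y ∷ ys) = last y ys

  IsCycle : List (Fin n) → Set
  IsCycle []               = ⊥
  IsCycle (x ∷ xs) =
    3 ≤ length (x ∷ xs) × Unique (x ∷ xs) × Chain (x ∷ xs) × Adj (last x xs) x

  Connected : Set
  Connected = ∀ u v → ∃[ k ] Walk u v k

  Acyclic : Set
  Acyclic = ∀ (c : List (Fin n)) → ¬ IsCycle c

  IsTree : Set
  IsTree = Connected × Acyclic

  degree : Fin n → ℕ
  degree v = ∣ tabulate (adj G v) ∣

  isLeaf : Fin n → Bool
  isLeaf v with degree v
  ... | 1 = true
  ... | _ = false

  numLeaves : ℕ
  numLeaves = ∣ tabulate isLeaf ∣

  DiameterAtMost : ℕ → Set
  DiameterAtMost d = ∀ u v → ∃[ k ] (k ≤ d × Walk u v k)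

  Disjoint : (Fin n × Fin n) → (Fin n × Fin n) → Set
  Disjoint (a , b) (c , d) = a ≢ c × a ≢ d × b ≢ c × b ≢ d

  IsMatching : List (Fin n × Fin n) → Set
  IsMatching M = AllEdges M × AllPairs Disjoint M
    where
    AllEdges : List (Fin n × Fin n) → Set
    AllEdges []             = ⊤
    AllEdges ((a , b) ∷ es) = Adj a b × AllEdges es

  MatchingNumberAtMost : ℕ → Set
  MatchingNumberAtMost m = ∀ M → IsMatching M → length M ≤ m

{-# OPTIONS --safe #-}
-- Root the tree at a centre r (a vertex of least eccentricity e) and let c be the neighbour of r
-- on the way to a vertex x farthest from r; the level of a vertex is its distance to the edge rc.
-- A vertex w outside the branch of c satisfies 2·depth w ≤ depth w + depth x ≤ d(w, x) ≤ 4t+3,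
-- and since the vertex farthest from c lies outside that branch and ecc r ≤ ecc c, every vertex
-- below c is within 2t+2 of r.  So all levels are at most 2t+1.  Adjacent vertices lie on
-- consecutive levels, except r and c which are both on level 0, hence the vertices of even level
-- meet every edge, and a matching has at most as many edges as there are such vertices.  Level 0
-- is {r, c}, and on any other level distinct vertices have distinct deepest leaves below them, so
-- each of the levels 2, 4, …, 2t holds at most b vertices.
module Submission where

open import Defs
open import Data.Nat using (ℕ; _+_; _*_; _≤_; _≥_)
open import Relation.Binary.PropositionalEquality using (_≡_)

open import Data.Nat using (zero; suc; pred; _<_; z≤n; s≤s; _≟_; ⌊_/2⌋; parity; ≢-nonZero)
open import Data.Nat.Properties
open import Data.Nat.Tactic.RingSolver using (solve-∀)
open import Data.Parity.Base using (0ℙ)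
open import Data.Bool using (Bool; true; false; T; if_then_else_)
open import Data.Bool.Properties using (¬-not; T-≡)
open import Data.Fin as Fin using (Fin; fromℕ<)
import Data.Fin.Properties as Finₚ
open import Data.Fin.Subset using (∣_∣)
open import Data.Vec using (tabulate)
open import Data.List using (List; []; _∷_; length; _++_; [_]; allFin)
open import Data.List.Properties using (length-++)
open import Data.List.Extrema.Nat using (argmax; argmin; f[xs]≤f[argmax]; f[argmin]≤f[xs])
open import Data.List.Membership.Propositional.Properties using (∈-allFin)
open import Data.List.Relation.Unary.All as All using (All; []; _∷_)
import Data.List.Relation.Unary.All.Properties as Allₚ
open import Data.List.Relation.Unary.AllPairs using (AllPairs; []; _∷_)
import Data.List.Relation.Unary.AllPairs.Properties as AllPairsₚ
open import Data.List.Relation.Unary.Unique.Propositional using (Unique)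
open import Data.Product using (Σ; _×_; ∃; _,_; proj₁; proj₂)
open import Data.Sum using (_⊎_; inj₁; inj₂; [_,_]′)
open import Data.Empty using (⊥; ⊥-elim)
open import Data.Unit using (tt)
open import Function using (_∘_)
open import Function.Bundles using (Equivalence)
open import Relation.Nullary using (¬_; Dec; yes; no)
open import Relation.Nullary.Decidable using (T?; _×-dec_)
open import Relation.Binary.Definitions using (tri<; tri≈; tri>)
open import Relation.Binary.PropositionalEquality as ≡
  using (_≢_; refl; trans; cong; cong₂; subst; subst₂; ≢-sym; module ≡-Reasoning)

even⊎even-suc : ∀ n → parity n ≡ 0ℙ ⊎ parity (suc n) ≡ 0ℙ
even⊎even-suc zero          = inj₁ refl
even⊎even-suc (suc zero)    = inj₂ refl
even⊎even-suc (suc (suc n)) = even⊎even-suc n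

even⇒⌊n/2⌋+⌊n/2⌋≡n : ∀ n → parity n ≡ 0ℙ → ⌊ n /2⌋ + ⌊ n /2⌋ ≡ n
even⇒⌊n/2⌋+⌊n/2⌋≡n zero          _  = refl
even⇒⌊n/2⌋+⌊n/2⌋≡n (suc zero)    ()
even⇒⌊n/2⌋+⌊n/2⌋≡n (suc (suc n)) ev =
  cong suc (trans (+-suc ⌊ n /2⌋ ⌊ n /2⌋) (cong suc (even⇒⌊n/2⌋+⌊n/2⌋≡n n ev)))

m+m≤1+n+n⇒m≤n : ∀ m n → m + m ≤ suc (n + n) → m ≤ n
m+m≤1+n+n⇒m≤n zero    n       _        = z≤n
m+m≤1+n+n⇒m≤n (suc m) zero    (s≤s le) rewrite +-suc m m with () ← le
m+m≤1+n+n⇒m≤n (suc m) (suc n) (s≤s le) rewrite +-suc m m | +-suc n n =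
  s≤s (m+m≤1+n+n⇒m≤n m n (≤-pred le))

pred-step : ∀ {m n} → m ≢ 0 → n ≡ suc m → pred n ≡ suc (pred m)
pred-step {m} m≢0 n≡1+m = trans (cong pred n≡1+m) (≡.sym (suc-pred m {{≢-nonZero m≢0}}))

q*b+r-injective : ∀ b {q q′ r r′} → r < b → r′ < b → q * b + r ≡ q′ * b + r′ → q ≡ q′ × r ≡ r′
q*b+r-injective b {zero}  {zero}   _   _    eq = refl , eq
q*b+r-injective b {zero}  {suc q′} r<b _    eq =
  ⊥-elim (<⇒≱ r<b (subst (b ≤_) (≡.sym eq) (≤-trans (m≤m+n b (q′ * b)) (m≤m+n _ _))))
q*b+r-injective b {suc q} {zero}   _   r′<b eq =
  ⊥-elim (<⇒≱ r′<b (subst (b ≤_) eq (≤-trans (m≤m+n b (q * b)) (m≤m+n _ _))))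
q*b+r-injective b {suc q} {suc q′} r<b r′<b eq
  with q*b+r-injective b {q} {q′} r<b r′<b
         (+-cancelˡ-≡ b _ _ (trans (≡.sym (+-assoc b (q * b) _)) (trans eq (+-assoc b (q′ * b) _))))
... | q≡q′ , r≡r′ = cong suc q≡q′ , r≡r′

4t+3≡1+[1+2t]+[1+2t] : ∀ t → 4 * t + 3 ≡ suc (suc (t + t) + suc (t + t))
4t+3≡1+[1+2t]+[1+2t] = solve-∀

least-satisfying : ∀ {P : ℕ → Set} → (∀ k → Dec (P k)) → ∀ {K} → P K →
                   Σ ℕ λ m → P m × (∀ {k} → P k → m ≤ k)
least-satisfying {P} P? {K} pK with P? 0
... | yes p0 = 0 , p0 , λ _ → z≤n
least-satisfying {P} P? {zero}  pK | no ¬p0 = ⊥-elim (¬p0 pK)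
least-satisfying {P} P? {suc K} pK | no ¬p0 with least-satisfying (P? ∘ suc) pK
... | m , pm , m-least = suc m , pm , above
  where
  above : ∀ {k} → P k → suc m ≤ k
  above {zero}  p0 = ⊥-elim (¬p0 p0)
  above {suc k} pk = s≤s (m-least pk)

module _ {A : Set} {P : A → Set} {R : A → A → Set} {N : ℕ}
         (code : ∀ x → P x → ℕ) (code< : ∀ {x} (px : P x) → code x px < N)
         (code-separates : ∀ {x y} (px : P x) (py : P y) → R x y → code x px ≢ code y py) where

  private
    codeAt : ∀ {xs} → All P xs → Fin (length xs) → ℕ
    codeAt (px ∷ _)   Fin.zero    = code _ px
    codeAt (_  ∷ pxs) (Fin.suc i) = codeAt pxs i

    codeAt< : ∀ {xs} (pxs : All P xs) i → codeAt pxs i < N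
    codeAt< (px ∷ _)   Fin.zero    = code< px
    codeAt< (_  ∷ pxs) (Fin.suc i) = codeAt< pxs i

    head-separated : ∀ {x xs} (px : P x) (pxs : All P xs) → All (R x) xs →
                     ∀ i → code x px ≢ codeAt pxs i
    head-separated px (py ∷ _)   (rxy ∷ _)   Fin.zero    = code-separates px py rxy
    head-separated px (_  ∷ pxs) (_   ∷ rxs) (Fin.suc i) = head-separated px pxs rxs i

    codeAt-injective : ∀ {xs} (pxs : All P xs) → AllPairs R xs →
                       ∀ i j → codeAt pxs i ≡ codeAt pxs j → i ≡ j
    codeAt-injective (_  ∷ _)   (_   ∷ _)    Fin.zero    Fin.zero    _  = refl
    codeAt-injective (px ∷ pxs) (rxs ∷ _)    Fin.zero    (Fin.suc j) eq =
      ⊥-elim (head-separated px pxs rxs j eq)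
    codeAt-injective (px ∷ pxs) (rxs ∷ _)    (Fin.suc i) Fin.zero    eq =
      ⊥-elim (head-separated px pxs rxs i (≡.sym eq))
    codeAt-injective (_  ∷ pxs) (_   ∷ rxss) (Fin.suc i) (Fin.suc j) eq =
      cong Fin.suc (codeAt-injective pxs rxss i j eq)

  length≤-of-separated-codes : ∀ {xs} → All P xs → AllPairs R xs → length xs ≤ N
  length≤-of-separated-codes pxs rxs = Finₚ.injective⇒≤ {f = λ i → fromℕ< (codeAt< pxs i)} λ {i} {j} eq →
    codeAt-injective pxs rxs i j (Finₚ.fromℕ<-injective _ _ (codeAt< pxs i) (codeAt< pxs j) eq)

∣tabulate∣-suc : ∀ {n} (p : Fin (suc n) → Bool) →
                 ∣ tabulate p ∣ ≡ (if p Fin.zero then 1 else 0) + ∣ tabulate (p ∘ Fin.suc) ∣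
∣tabulate∣-suc p with p Fin.zero
... | true  = refl
... | false = refl

∣tabulate∣≡0 : ∀ {n} (p : Fin n → Bool) → (∀ i → p i ≡ false) → ∣ tabulate p ∣ ≡ 0
∣tabulate∣≡0 {zero}  p _ = refl
∣tabulate∣≡0 {suc n} p none rewrite ∣tabulate∣-suc p | none Fin.zero =
  ∣tabulate∣≡0 (p ∘ Fin.suc) (none ∘ Fin.suc)

∣tabulate∣≡1 : ∀ {n} (p : Fin n → Bool) a → p a ≡ true → (∀ i → p i ≡ true → i ≡ a) →
               ∣ tabulate p ∣ ≡ 1
∣tabulate∣≡1 {suc n} p Fin.zero    pa only rewrite ∣tabulate∣-suc p | pa =
  cong suc (∣tabulate∣≡0 (p ∘ Fin.suc) λ i → ¬-not λ pi → Finₚ.0≢1+n (≡.sym (only (Fin.suc i) pi)))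
∣tabulate∣≡1 {suc n} p (Fin.suc a) pa only
  rewrite ∣tabulate∣-suc p | ¬-not {p Fin.zero} (λ p0 → Finₚ.0≢1+n (only Fin.zero p0)) =
  ∣tabulate∣≡1 (p ∘ Fin.suc) a pa (λ i pi → Finₚ.suc-injective (only (Fin.suc i) pi))

rank : ∀ {n} → (Fin n → Bool) → Fin n → ℕ
rank p Fin.zero    = 0
rank p (Fin.suc i) = (if p Fin.zero then 1 else 0) + rank (p ∘ Fin.suc) i

rank<∣tabulate∣ : ∀ {n} (p : Fin n → Bool) i → p i ≡ true → rank p i < ∣ tabulate p ∣
rank<∣tabulate∣ {suc n} p Fin.zero    pi rewrite ∣tabulate∣-suc p | pi = s≤s z≤n
rank<∣tabulate∣ {suc n} p (Fin.suc i) pi rewrite ∣tabulate∣-suc p =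
  +-monoʳ-< (if p Fin.zero then 1 else 0) (rank<∣tabulate∣ (p ∘ Fin.suc) i pi)

rank-injective : ∀ {n} (p : Fin n → Bool) i j → p i ≡ true → p j ≡ true → rank p i ≡ rank p j → i ≡ j
rank-injective p Fin.zero    Fin.zero    _  _  _  = refl
rank-injective p Fin.zero    (Fin.suc j) p0 _  eq rewrite p0 with () ← eq
rank-injective p (Fin.suc i) Fin.zero    _  p0 eq rewrite p0 with () ← eq
rank-injective p (Fin.suc i) (Fin.suc j) pi pj eq =
  cong Fin.suc (rank-injective (p ∘ Fin.suc) i j pi pj (+-cancelˡ-≡ (if p Fin.zero then 1 else 0) _ _ eq))

Unique-∷ʳ : ∀ {A : Set} {xs : List A} {y} → Unique xs → All (y ≢_) xs → Unique (xs ++ [ y ])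
Unique-∷ʳ u y∉xs = AllPairsₚ.++⁺ u ([] ∷ []) (All.map (λ y≢x → ≢-sym y≢x ∷ []) y∉xs)

module _ {n : ℕ} (G : Graph n) where

  Adj-sym : ∀ {u v} → Adj G u v → Adj G v u
  Adj-sym {u} {v} = subst T (sym G u v)

  Adj⇒≢ : ∀ {u v} → Adj G u v → u ≢ v
  Adj⇒≢ {u} a refl = subst T (irrefl G u) a

  degree≡1⇒isLeaf : ∀ v → degree G v ≡ 1 → isLeaf G v ≡ true
  degree≡1⇒isLeaf v deg≡1 rewrite deg≡1 = refl

  walk? : ∀ k u v → Dec (Walk G u v k)
  walk? zero u v with u Fin.≟ v
  ... | yes refl = yes here
  ... | no  u≢v  = no λ { here → u≢v refl }
  walk? (suc k) u v with Finₚ.any? (λ w → T? (adj G u w) ×-dec walk? k w v)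
  ... | yes (w , a , p) = yes (step a p)
  ... | no  ∄w          = no λ { (step a p) → ∄w (_ , a , p) }

  Walk-0 : ∀ {u v} → Walk G u v 0 → u ≡ v
  Walk-0 here = refl

  next-vertex : ∀ {u v k} → Walk G u v k → Fin n
  next-vertex {u} here               = u
  next-vertex     (step {w = w} _ _) = w

  last-∷ʳ : ∀ x xs y → last G x (xs ++ [ y ]) ≡ y
  last-∷ʳ x []       y = refl
  last-∷ʳ x (z ∷ xs) y = last-∷ʳ z xs y

  Chain-∷ʳ : ∀ x xs {y} → Chain G (x ∷ xs) → Adj G (last G x xs) y → Chain G (x ∷ xs ++ [ y ])
  Chain-∷ʳ x []       _        a = a , tt
  Chain-∷ʳ x (z ∷ xs) (a′ , c) a = a′ , Chain-∷ʳ z xs c a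

  private
    Edge : Fin n × Fin n → Set
    Edge (u , v) = Adj G u v

    matching-edges : ∀ {M} → IsMatching G M → All Edge M
    matching-edges {[]}    _                     = []
    matching-edges {_ ∷ M} ((a , as) , (_ ∷ ds)) = a ∷ matching-edges {M} (as , ds)

    endpoints-differ : ∀ {x y x′ y′ w w′} → w ≡ x ⊎ w ≡ y → w′ ≡ x′ ⊎ w′ ≡ y′ →
                       Disjoint G (x , y) (x′ , y′) → w ≢ w′
    endpoints-differ (inj₁ refl) (inj₁ refl) (x≢x′ , _    , _    , _   ) = x≢x′
    endpoints-differ (inj₁ refl) (inj₂ refl) (_    , x≢y′ , _    , _   ) = x≢y′
    endpoints-differ (inj₂ refl) (inj₁ refl) (_    , _    , y≢x′ , _   ) = y≢x′
    endpoints-differ (inj₂ refl) (inj₂ refl) (_    , _    , _    , y≢y′) = y≢y′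

  matching≤cover : ∀ {N} (Cover : Fin n → Set) → (∀ {u v} → Adj G u v → Cover u ⊎ Cover v) →
                   (code : Fin n → ℕ) → (∀ {w} → Cover w → code w < N) →
                   (∀ {w w′} → Cover w → Cover w′ → code w ≡ code w′ → w ≡ w′) →
                   MatchingNumberAtMost G N
  matching≤cover Cover covers code code< code-injective M matching@(_ , disjoint) =
    length≤-of-separated-codes edge-code (λ a → code< (proj₁ (proj₂ (covered-end a)))) separated
      (matching-edges {M} matching) disjoint
    where
    covered-end : ∀ {u v} → Adj G u v → Σ (Fin n) λ w → Cover w × (w ≡ u ⊎ w ≡ v)
    covered-end {u} {v} a with covers a
    ... | inj₁ cu = u , cu , inj₁ refl
    ... | inj₂ cv = v , cv , inj₂ refl

    edge-code : ∀ e → Edge e → ℕ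
    edge-code _ a = code (proj₁ (covered-end a))

    separated : ∀ {e e′} (a : Edge e) (a′ : Edge e′) → Disjoint G e e′ → edge-code e a ≢ edge-code e′ a′
    separated a a′ disj with covered-end a | covered-end a′
    ... | w , cw , w∈e | w′ , cw′ , w′∈e′ = endpoints-differ w∈e w′∈e′ disj ∘ code-injective cw cw′

  edgeless⇒matching≤ : (∀ {u v} → ¬ Adj G u v) → ∀ N → MatchingNumberAtMost G N
  edgeless⇒matching≤ no-edge N []      _             = z≤n
  edgeless⇒matching≤ no-edge N (_ ∷ _) ((a , _) , _) = ⊥-elim (no-edge a)

module RootedTree {n : ℕ} (G : Graph n) (connected : Connected G) (acyclic : Acyclic G) (r : Fin n) where

  -- Opaque: only the shortest-walk characterisation of depth is used below, and unfolding the
  -- search for a shortest walk is expensive.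
  opaque
    private
      shortest : ∀ w → Σ ℕ λ m → Walk G w r m × (∀ {k} → Walk G w r k → m ≤ k)
      shortest w = least-satisfying (λ k → walk? G k w r) (proj₂ (connected w r))

    depth : Fin n → ℕ
    depth w = proj₁ (shortest w)

    shortest-walk : ∀ w → Walk G w r (depth w)
    shortest-walk w = proj₁ (proj₂ (shortest w))

    depth-minimal : ∀ {w k} → Walk G w r k → depth w ≤ k
    depth-minimal {w} = proj₂ (proj₂ (shortest w))

  depth-root : depth r ≡ 0
  depth-root = n≤0⇒n≡0 (depth-minimal here)

  depth≡0⇒root : ∀ w → depth w ≡ 0 → w ≡ r
  depth≡0⇒root w dw≡0 = Walk-0 G (subst (Walk G w r) dw≡0 (shortest-walk w))

  depth-adj : ∀ {u v} → Adj G u v → depth u ≤ suc (depth v)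
  depth-adj {v = v} a = depth-minimal (step a (shortest-walk v))

  depth-start≤ : ∀ {u w k} → Walk G u w k → depth u ≤ k + depth w
  depth-start≤ here       = ≤-refl
  depth-start≤ (step a p) = ≤-trans (depth-adj a) (s≤s (depth-start≤ p))

  depth-end≤ : ∀ {u w k} → Walk G u w k → depth w ≤ k + depth u
  depth-end≤ here                               = ≤-refl
  depth-end≤ {u} {w} (step {w = z} {k = k} a p) = begin
    depth w            ≤⟨ depth-end≤ p ⟩
    k + depth z        ≤⟨ +-monoʳ-≤ k (depth-adj (Adj-sym G a)) ⟩
    k + suc (depth u)  ≡⟨ +-suc k (depth u) ⟩
    suc (k + depth u)  ∎
    where open ≤-Reasoning

  parent : Fin n → Fin n
  parent v = next-vertex G (shortest-walk v)

  parent-spec : ∀ v {m} → depth v ≡ suc m → Adj G v (parent v) × depth (parent v) ≡ m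
  parent-spec v {m} dv = next-spec (shortest-walk v) dv
    where
    next-spec : ∀ {k} (p : Walk G v r k) → k ≡ suc m →
                Adj G v (next-vertex G p) × depth (next-vertex G p) ≡ m
    next-spec (step a p) refl = a , ≤-antisym (depth-minimal p) (≤-pred (subst (_≤ _) dv (depth-adj a)))

  private
    shallower-∉ : ∀ {v m zs} → depth v ≡ m → All (λ z → suc m ≤ depth z) zs → All (v ≢_) zs
    shallower-∉ dv = All.map λ deep v≡z →
      <-irrefl refl (≤-trans deep (≤-reflexive (trans (cong depth (≡.sym v≡z)) dv)))

    deep-path : ∀ {m x y} mid → depth x ≡ m → depth y ≡ m → All (λ z → m ≤ depth z) mid →
                All (λ z → m ≤ depth z) (x ∷ mid ++ [ y ])
    deep-path mid dx dy mid-deep = ≤-reflexive (≡.sym dx) ∷ Allₚ.++⁺ mid-deep (≤-reflexive (≡.sym dy) ∷ [])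

  -- Replacing both ends by their parents either closes a cycle (equal parents) or gives such a
  -- path one level higher.
  no-path-above : ∀ m {x y} mid → depth x ≡ m → depth y ≡ m → All (λ z → m ≤ depth z) mid →
                  Unique (x ∷ mid ++ [ y ]) → Chain G (x ∷ mid ++ [ y ]) → ⊥
  no-path-above zero    {x} {y} mid dx dy _ (x∉ ∷ _) _ =
    All.head (Allₚ.++⁻ʳ mid x∉) (trans (depth≡0⇒root x dx) (≡.sym (depth≡0⇒root y dy)))
  no-path-above (suc m) {x} {y} mid dx dy mid-deep uniq chain
    with parent-spec x dx | parent-spec y dy | parent x Fin.≟ parent y
  ... | x↑ , dpx | y↑ , dpy | yes px≡py =
    acyclic (parent x ∷ x ∷ mid ++ [ y ]) (3≤length , px∉ ∷ uniq , (Adj-sym G x↑ , chain) , closing)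
    where
    3≤length : 3 ≤ length (parent x ∷ x ∷ mid ++ [ y ])
    3≤length = s≤s (s≤s (subst (1 ≤_) (≡.sym (length-++ mid)) (m≤n+m 1 (length mid))))
    px∉ : All (parent x ≢_) (x ∷ mid ++ [ y ])
    px∉ = shallower-∉ dpx (deep-path mid dx dy mid-deep)
    closing : Adj G (last G (parent x) (x ∷ mid ++ [ y ])) (parent x)
    closing = subst₂ (Adj G) (≡.sym (last-∷ʳ G x mid y)) (≡.sym px≡py) y↑
  ... | x↑ , dpx | y↑ , dpy | no px≢py =
    no-path-above m (x ∷ mid ++ [ y ]) dpx dpy (All.map (≤-trans (n≤1+n m)) path-deep)
      (Allₚ.++⁺ (shallower-∉ dpx path-deep) (px≢py ∷ []) ∷ Unique-∷ʳ uniq (shallower-∉ dpy path-deep))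
      (Adj-sym G x↑ , Chain-∷ʳ G x (mid ++ [ y ]) chain y→py)
    where
    path-deep : All (λ z → suc m ≤ depth z) (x ∷ mid ++ [ y ])
    path-deep = deep-path mid dx dy mid-deep
    y→py : Adj G (last G x (mid ++ [ y ])) (parent y)
    y→py = subst (λ z → Adj G z (parent y)) (≡.sym (last-∷ʳ G x mid y)) y↑

  adj⇒depth≢ : ∀ {u v} → Adj G u v → depth u ≢ depth v
  adj⇒depth≢ {u} a du≡dv =
    no-path-above (depth u) [] refl (≡.sym du≡dv) [] ((Adj⇒≢ G a ∷ []) ∷ [] ∷ []) (a , tt)

  parent-unique : ∀ {u v} → Adj G u v → depth v ≡ suc (depth u) → u ≡ parent v
  parent-unique {u} {v} a dv with parent-spec v dv | u Fin.≟ parent v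
  ... | _  , _  | yes u≡p = u≡p
  ... | v↑ , dp | no  u≢p = ⊥-elim (no-path-above (depth u) [ v ] refl dp v-deep
                              ((Adj⇒≢ G a ∷ u≢p ∷ []) ∷ (Adj⇒≢ G v↑ ∷ []) ∷ [] ∷ []) (a , v↑ , tt))
    where
    v-deep : All (λ z → depth u ≤ depth z) [ v ]
    v-deep = subst (depth u ≤_) (≡.sym dv) (n≤1+n _) ∷ []

  adj⇒depth-step : ∀ {u v} → Adj G u v → depth v ≡ suc (depth u) ⊎ depth u ≡ suc (depth v)
  adj⇒depth-step {u} {v} a with <-cmp (depth u) (depth v)
  ... | tri< du<dv _ _ = inj₁ (≤-antisym (depth-adj (Adj-sym G a)) du<dv)
  ... | tri≈ _ du≡dv _ = ⊥-elim (adj⇒depth≢ a du≡dv)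
  ... | tri> _ _ dv<du = inj₂ (≤-antisym (depth-adj a) dv<du)

  ancestor : ℕ → Fin n → Fin n
  ancestor zero    v = v
  ancestor (suc j) v = ancestor j (parent v)

  depth-ancestor : ∀ j {v m} → depth v ≡ j + m → depth (ancestor j v) ≡ m
  depth-ancestor zero        dv = dv
  depth-ancestor (suc j) {v} dv = depth-ancestor j (proj₂ (parent-spec v dv))

  ancestor-walk : ∀ j {v m} → depth v ≡ j + m → Walk G v (ancestor j v) j
  ancestor-walk zero        dv = here
  ancestor-walk (suc j) {v} dv with parent-spec v dv
  ... | v↑ , dp = step v↑ (ancestor-walk j dp)

  ancestor-+ : ∀ i j v → ancestor (i + j) v ≡ ancestor j (ancestor i v)
  ancestor-+ zero    j v = refl
  ancestor-+ (suc i) j v = ancestor-+ i j (parent v)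

  ancestor-suc : ∀ j v → ancestor (suc j) v ≡ parent (ancestor j v)
  ancestor-suc zero    v = refl
  ancestor-suc (suc j) v = ancestor-suc j (parent v)

  Childless : Fin n → Set
  Childless w = ∀ u → Adj G w u → depth u ≢ suc (depth w)

  child? : ∀ w → Dec (∃ λ u → Adj G w u × depth u ≡ suc (depth w))
  child? w = Finₚ.any? λ u → T? (adj G w u) ×-dec (depth u ≟ suc (depth w))

  descend : ℕ → Fin n → Fin n
  descend zero    w = w
  descend (suc f) w with child? w
  ... | yes (u , _) = descend f u
  ... | no  _       = w

  descend-ancestor : ∀ f w → ∃ λ j → depth (descend f w) ≡ j + depth w × ancestor j (descend f w) ≡ w
  descend-ancestor zero    w = 0 , refl , refl
  descend-ancestor (suc f) w with child? w
  ... | no  _               = 0 , refl , refl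
  ... | yes (u , w→u , du) with descend-ancestor f u
  ...   | j , dℓ , ℓ↑u =
    suc j , trans dℓ (trans (cong (j +_) du) (+-suc j (depth w))) ,
    trans (ancestor-suc j _) (trans (cong parent ℓ↑u) (≡.sym (parent-unique w→u du)))

  descend-childless : ∀ {D} → (∀ z → depth z ≤ D) → ∀ f w → D < depth w + f → Childless (descend f w)
  descend-childless     bounded zero    w D<d = ⊥-elim (<⇒≱ (subst (_ <_) (+-identityʳ _) D<d) (bounded w))
  descend-childless {D} bounded (suc f) w D<d with child? w
  ... | no  ∄child      = λ u a du → ∄child (u , a , du)
  ... | yes (u , _ , du) =
    descend-childless bounded f u (subst (D <_) (trans (+-suc (depth w) f) (cong (_+ f) (≡.sym du))) D<d)

  childless⇒leaf : ∀ ℓ → depth ℓ ≢ 0 → Childless ℓ → isLeaf G ℓ ≡ true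
  childless⇒leaf ℓ dℓ≢0 childless =
    degree≡1⇒isLeaf G ℓ (∣tabulate∣≡1 (adj G ℓ) (parent ℓ) (Equivalence.to T-≡ ℓ↑) only-parent)
    where
    ℓ↑ : Adj G ℓ (parent ℓ)
    ℓ↑ = proj₁ (parent-spec ℓ (≡.sym (suc-pred (depth ℓ) {{≢-nonZero dℓ≢0}})))
    only-parent : ∀ u → adj G ℓ u ≡ true → u ≡ parent ℓ
    only-parent u ℓu≡true = [ (λ du → ⊥-elim (childless u ℓ–u du)) , parent-unique (Adj-sym G ℓ–u) ]′
                              (adj⇒depth-step ℓ–u)
      where
      ℓ–u : Adj G ℓ u
      ℓ–u = Equivalence.from T-≡ ℓu≡true

  branch : Fin n → Fin n
  branch w = ancestor (pred (depth w)) w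

  branch-depth1 : ∀ u → depth u ≡ 1 → branch u ≡ u
  branch-depth1 u du = cong (λ d → ancestor (pred d) u) du

  branch-ancestor : ∀ ℓ j w → depth w ≢ 0 → depth ℓ ≡ j + depth w → ancestor j ℓ ≡ w →
                    branch ℓ ≡ branch w
  branch-ancestor ℓ j w dw≢0 dℓ ℓ↑w = begin
    ancestor (pred (depth ℓ)) ℓ              ≡⟨ cong (λ d → ancestor (pred d) ℓ) dℓ ⟩
    ancestor (pred (j + depth w)) ℓ          ≡⟨ cong (λ d → ancestor d ℓ) (+-∸-assoc j (n≢0⇒n>0 dw≢0)) ⟩
    ancestor (j + pred (depth w)) ℓ          ≡⟨ ancestor-+ j _ ℓ ⟩
    ancestor (pred (depth w)) (ancestor j ℓ) ≡⟨ cong (ancestor (pred (depth w))) ℓ↑w ⟩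
    branch w                                 ∎
    where open ≡-Reasoning

  adj⇒same-branch : ∀ {u v} → Adj G u v → depth u ≢ 0 → depth v ≢ 0 → branch u ≡ branch v
  adj⇒same-branch {u} {v} a du≢0 dv≢0 with adj⇒depth-step a
  ... | inj₁ dv = ≡.sym (branch-ancestor v 1 u du≢0 dv (≡.sym (parent-unique a dv)))
  ... | inj₂ du = branch-ancestor u 1 v dv≢0 du (≡.sym (parent-unique (Adj-sym G a) du))

module LevelCover {n : ℕ} (G : Graph n) (b t : ℕ) (r : Fin n) (level : Fin n → ℕ) (leaf : Fin n → Fin n)
  (level-adj : ∀ {u v} → Adj G u v →
               level u ≡ suc (level v) ⊎ level v ≡ suc (level u) ⊎ (level u ≡ 0 × level v ≡ 0))
  (level≤ : ∀ w → level w ≤ suc (t + t))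
  (level≡0-unique : ∀ {w w′} → level w ≡ 0 → level w′ ≡ 0 → w ≢ r → w′ ≢ r → w ≡ w′)
  (leaf-isLeaf : ∀ w → level w ≢ 0 → isLeaf G (leaf w) ≡ true)
  (leaf-injective : ∀ {w w′} → level w ≡ level w′ → level w ≢ 0 → leaf w ≡ leaf w′ → w ≡ w′)
  (leaves : numLeaves G ≡ b) where

  Covered : Fin n → Set
  Covered w = parity (level w) ≡ 0ℙ

  covers : ∀ {u v} → Adj G u v → Covered u ⊎ Covered v
  covers {u} {v} a with level-adj a
  ... | inj₁ lu with even⊎even-suc (level v)
  ...   | inj₁ ev = inj₂ ev
  ...   | inj₂ ev = inj₁ (trans (cong parity lu) ev)
  covers {u} {v} a | inj₂ (inj₁ lv) with even⊎even-suc (level u)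
  ...   | inj₁ eu = inj₁ eu
  ...   | inj₂ eu = inj₂ (trans (cong parity lv) eu)
  covers a | inj₂ (inj₂ (lu , _)) = inj₁ (cong parity lu)

  private
    half : Fin n → ℕ
    half w = ⌊ level w /2⌋

    half+half : ∀ {w} → Covered w → half w + half w ≡ level w
    half+half {w} = even⇒⌊n/2⌋+⌊n/2⌋≡n (level w)

    half≢0 : ∀ {w} → Covered w → level w ≢ 0 → half w ≢ 0
    half≢0 {w} cw lw≢0 hw≡0 = lw≢0 (trans (≡.sym (half+half cw)) (cong (λ h → h + h) hw≡0))

    half≤t : ∀ {w} → Covered w → half w ≤ t
    half≤t {w} cw = m+m≤1+n+n⇒m≤n (half w) t (subst (_≤ _) (≡.sym (half+half cw)) (level≤ w))

    leafRank : Fin n → ℕ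
    leafRank w = rank (isLeaf G) (leaf w)

    leafRank<b : ∀ {w} → level w ≢ 0 → leafRank w < b
    leafRank<b {w} lw≢0 =
      subst (leafRank w <_) leaves (rank<∣tabulate∣ (isLeaf G) (leaf w) (leaf-isLeaf w lw≢0))

    deepCode : Fin n → ℕ
    deepCode w = pred (half w) * b + leafRank w

    deepCode< : ∀ {w} → Covered w → level w ≢ 0 → deepCode w < b * t
    deepCode< {w} cw lw≢0 = begin-strict
      pred (half w) * b + leafRank w  <⟨ +-monoʳ-< (pred (half w) * b) (leafRank<b lw≢0) ⟩
      pred (half w) * b + b           ≡⟨ +-comm (pred (half w) * b) b ⟩
      suc (pred (half w)) * b         ≡⟨ cong (_* b) (suc-pred (half w) {{≢-nonZero (half≢0 cw lw≢0)}}) ⟩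
      half w * b                      ≤⟨ *-monoˡ-≤ b (half≤t cw) ⟩
      t * b                           ≡⟨ *-comm t b ⟩
      b * t                           ∎
      where open ≤-Reasoning

    deepCode-injective : ∀ {w w′} → Covered w → Covered w′ → level w ≢ 0 → level w′ ≢ 0 →
                         deepCode w ≡ deepCode w′ → w ≡ w′
    deepCode-injective {w} {w′} cw cw′ lw≢0 lw′≢0 eq
      with q*b+r-injective b (leafRank<b lw≢0) (leafRank<b lw′≢0) eq
    ... | pred-half≡ , rank≡ = leaf-injective level≡ lw≢0
            (rank-injective (isLeaf G) (leaf w) (leaf w′) (leaf-isLeaf w lw≢0) (leaf-isLeaf w′ lw′≢0) rank≡)
      where
      half≡ : half w ≡ half w′
      half≡ = pred-injective {{≢-nonZero (half≢0 cw lw≢0)}} {{≢-nonZero (half≢0 cw′ lw′≢0)}} pred-half≡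
      level≡ : level w ≡ level w′
      level≡ = trans (≡.sym (half+half cw)) (trans (cong (λ h → h + h) half≡) (half+half cw′))

  code : Fin n → ℕ
  code w with level w ≟ 0 | w Fin.≟ r
  ... | yes _ | yes _ = 0
  ... | yes _ | no  _ = 1
  ... | no  _ | _     = 2 + deepCode w

  code< : ∀ {w} → Covered w → code w < b * t + 2
  code< {w} cw with level w ≟ 0 | w Fin.≟ r
  ... | yes _     | yes _ = subst (0 <_) (+-comm 2 (b * t)) (s≤s z≤n)
  ... | yes _     | no  _ = subst (1 <_) (+-comm 2 (b * t)) (s≤s (s≤s z≤n))
  ... | no  lw≢0  | _     = subst (2 + deepCode w <_) (+-comm 2 (b * t)) (+-monoʳ-< 2 (deepCode< cw lw≢0))

  code-injective : ∀ {w w′} → Covered w → Covered w′ → code w ≡ code w′ → w ≡ w′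
  code-injective {w} {w′} cw cw′ eq with level w ≟ 0 | w Fin.≟ r | level w′ ≟ 0 | w′ Fin.≟ r
  ... | yes _    | yes w≡r | yes _     | yes w′≡r = trans w≡r (≡.sym w′≡r)
  ... | yes lw   | no  w≢r | yes lw′   | no  w′≢r = level≡0-unique lw lw′ w≢r w′≢r
  ... | no  lw≢0 | _       | no  lw′≢0 | _        =
    deepCode-injective cw cw′ lw≢0 lw′≢0 (suc-injective (suc-injective eq))
  ... | yes _    | yes _   | yes _     | no  _    with () ← eq
  ... | yes _    | no  _   | yes _     | yes _    with () ← eq
  ... | yes _    | yes _   | no  _     | _        with () ← eq
  ... | yes _    | no  _   | no  _     | _        with () ← eq
  ... | no  _    | _       | yes _     | yes _    with () ← eq
  ... | no  _    | _       | yes _     | no  _    with () ← eq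

  matching≤ : MatchingNumberAtMost G (b * t + 2)
  matching≤ = matching≤cover G Covered covers code code< code-injective

module Eccentricity {n : ℕ} (G : Graph n) (connected : Connected G) (acyclic : Acyclic G) where

  distance : Fin n → Fin n → ℕ
  distance v = RootedTree.depth G connected acyclic v

  farthest : Fin n → Fin n
  farthest v = argmax (distance v) v (allFin n)

  eccentricity : Fin n → ℕ
  eccentricity v = distance v (farthest v)

  distance≤eccentricity : ∀ v w → distance v w ≤ eccentricity v
  distance≤eccentricity v w =
    All.lookup (f[xs]≤f[argmax] {f = distance v} v (allFin n)) (∈-allFin w)

  centre : Fin n → Fin n
  centre v = argmin eccentricity v (allFin n)

  centre-minimal : ∀ v w → eccentricity (centre v) ≤ eccentricity w
  centre-minimal v w =
    All.lookup (f[argmin]≤f[xs] {f = eccentricity} v (allFin n)) (∈-allFin w)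

  eccentricity≡0⇒edgeless : ∀ v → eccentricity v ≡ 0 → ∀ {u w} → ¬ Adj G u w
  eccentricity≡0⇒edgeless v ecc≡0 {u} {w} a = Adj⇒≢ G a (trans (is-v u) (≡.sym (is-v w)))
    where
    is-v : ∀ z → z ≡ v
    is-v z = RootedTree.depth≡0⇒root G connected acyclic v z
               (n≤0⇒n≡0 (subst (distance v z ≤_) ecc≡0 (distance≤eccentricity v z)))

module _ {n : ℕ} (G : Graph n) (connected : Connected G) (acyclic : Acyclic G) (b t : ℕ)
  (leaves : numLeaves G ≡ b) (diameter≤ : DiameterAtMost G (4 * t + 3)) where

  open Eccentricity G connected acyclic

  module CentralEdge (r : Fin n) (r-centre : ∀ v → eccentricity r ≤ eccentricity v)
                     (e : ℕ) (ecc-r : eccentricity r ≡ suc e) where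

    open RootedTree G connected acyclic r
    module Rooted = RootedTree G connected acyclic

    x : Fin n
    x = farthest r

    depth-x : depth x ≡ suc e
    depth-x = ecc-r

    depth≤ : ∀ w → depth w ≤ suc e
    depth≤ w = subst (depth w ≤_) ecc-r (distance≤eccentricity r w)

    c : Fin n
    c = ancestor e x

    depth-c : depth c ≡ 1
    depth-c = depth-ancestor e (trans depth-x (+-comm 1 e))

    r–c : Adj G r c
    r–c with parent-spec c depth-c
    ... | c↑ , dp = subst (λ z → Adj G z c) (depth≡0⇒root (parent c) dp) (Adj-sym G c↑)

    InBranch : Fin n → Set
    InBranch w = branch w ≡ c

    inBranch? : ∀ w → Dec (InBranch w)
    inBranch? w = branch w Fin.≟ c

    inBranch⇒depth≢0 : ∀ w → InBranch w → depth w ≢ 0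
    inBranch⇒depth≢0 w w∈ dw≡0 = 1+n≢0 (trans (≡.sym depth-c) (trans (cong depth (≡.sym w≡c)) dw≡0))
      where
      w≡c : w ≡ c
      w≡c = trans (≡.sym (cong (λ d → ancestor (pred d) w) dw≡0)) w∈

    x∈branch : InBranch x
    x∈branch = cong (λ d → ancestor (pred d) x) depth-x

    crossing : ∀ {u w} → Adj G u w → InBranch u → ¬ InBranch w → u ≡ c × w ≡ r
    crossing {u} {w} a u∈ w∉ with depth w ≟ 0
    ... | yes dw≡0 = trans (≡.sym (branch-depth1 u du≡1)) u∈ , depth≡0⇒root w dw≡0
      where
      du≡1 : depth u ≡ 1
      du≡1 = ≤-antisym (subst (λ d → depth u ≤ suc d) dw≡0 (depth-adj a))
                       (n≢0⇒n>0 (inBranch⇒depth≢0 u u∈))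
    ... | no dw≢0 = ⊥-elim (w∉ (trans (≡.sym (adj⇒same-branch a (inBranch⇒depth≢0 u u∈) dw≢0)) u∈))

    walk-into-branch : ∀ {u w k} → Walk G u w k → ¬ InBranch u → InBranch w → depth u + depth w ≤ k
    walk-into-branch here u∉ w∈ = ⊥-elim (u∉ w∈)
    walk-into-branch {u} {w} (step {w = z} {k = k} a p) u∉ w∈ with inBranch? z
    ... | no z∉ = ≤-trans (+-monoˡ-≤ (depth w) (depth-adj a)) (s≤s (walk-into-branch p z∉ w∈))
    ... | yes z∈ with crossing (Adj-sym G a) z∈ u∉
    ...   | refl , refl rewrite depth-root =
      ≤-trans (depth-end≤ p) (≤-reflexive (trans (cong (k +_) depth-c) (+-comm k 1)))

    outside-depth≤ : ∀ w → ¬ InBranch w → depth w ≤ suc (t + t)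
    outside-depth≤ w w∉ with diameter≤ w x
    ... | k , k≤ , p = m+m≤1+n+n⇒m≤n (depth w) (suc (t + t)) (begin
      depth w + depth w  ≤⟨ +-monoʳ-≤ (depth w) (subst (depth w ≤_) (≡.sym depth-x) (depth≤ w)) ⟩
      depth w + depth x  ≤⟨ walk-into-branch p w∉ x∈branch ⟩
      k                  ≤⟨ k≤ ⟩
      4 * t + 3          ≡⟨ 4t+3≡1+[1+2t]+[1+2t] t ⟩
      suc (suc (t + t) + suc (t + t)) ∎)
      where open ≤-Reasoning

    private
      eccentricity-c : suc e ≤ eccentricity c
      eccentricity-c = subst (_≤ eccentricity c) ecc-r (r-centre c)

      -- Otherwise c would have smaller eccentricity than the centre r.
      farthest-from-c∉branch : ¬ InBranch (farthest c)
      farthest-from-c∉branch y∈ = <⇒≱ eccentricity-c (begin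
        eccentricity c  ≤⟨ Rooted.depth-minimal c (subst (λ z → Walk G y z (pred (depth y))) y∈ y→c) ⟩
        pred (depth y)  ≤⟨ pred-mono-≤ (depth≤ y) ⟩
        e               ∎)
        where
        open ≤-Reasoning
        y = farthest c
        y→c : Walk G y (ancestor (pred (depth y)) y) (pred (depth y))
        y→c = ancestor-walk (pred (depth y))
                (trans (≡.sym (suc-pred (depth y) {{≢-nonZero (inBranch⇒depth≢0 y y∈)}})) (+-comm 1 _))

    e+1≤2t+2 : suc e ≤ suc (suc (t + t))
    e+1≤2t+2 = begin
      suc e                      ≤⟨ eccentricity-c ⟩
      distance c y               ≤⟨ Rooted.depth-start≤ c (shortest-walk y) ⟩
      depth y + distance c r     ≤⟨ +-mono-≤ (outside-depth≤ y farthest-from-c∉branch)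
                                             (Rooted.depth-minimal c (step r–c here)) ⟩
      suc (t + t) + 1            ≡⟨ +-comm (suc (t + t)) 1 ⟩
      suc (suc (t + t))          ∎
      where
      open ≤-Reasoning
      y = farthest c

    level : Fin n → ℕ
    level w with inBranch? w
    ... | yes _ = pred (depth w)
    ... | no  _ = depth w

    level-adj : ∀ {u v} → Adj G u v →
                level u ≡ suc (level v) ⊎ level v ≡ suc (level u) ⊎ (level u ≡ 0 × level v ≡ 0)
    level-adj {u} {v} a with inBranch? u | inBranch? v
    ... | yes u∈ | yes v∈ with adj⇒depth-step a
    ...   | inj₁ dv = inj₂ (inj₁ (pred-step (inBranch⇒depth≢0 u u∈) dv))
    ...   | inj₂ du = inj₁ (pred-step (inBranch⇒depth≢0 v v∈) du)
    level-adj a | no u∉ | no v∉ with adj⇒depth-step a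
    ...   | inj₁ dv = inj₂ (inj₁ dv)
    ...   | inj₂ du = inj₁ du
    level-adj a | yes u∈ | no v∉ with crossing a u∈ v∉
    ...   | refl , refl = inj₂ (inj₂ (cong pred depth-c , depth-root))
    level-adj a | no u∉ | yes v∈ with crossing (Adj-sym G a) v∈ u∉
    ...   | refl , refl = inj₂ (inj₂ (depth-root , cong pred depth-c))

    level≤ : ∀ w → level w ≤ suc (t + t)
    level≤ w with inBranch? w
    ... | yes _  = ≤-trans (pred-mono-≤ (depth≤ w)) (≤-pred e+1≤2t+2)
    ... | no w∉ = outside-depth≤ w w∉

    level≡0⇒c : ∀ w → level w ≡ 0 → w ≢ r → w ≡ c
    level≡0⇒c w lw≡0 w≢r with inBranch? w
    ... | yes w∈ = trans (≡.sym (branch-depth1 w dw≡1)) w∈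
      where
      dw≡1 : depth w ≡ 1
      dw≡1 = pred-injective {{≢-nonZero (inBranch⇒depth≢0 w w∈)}} lw≡0
    ... | no  _  = ⊥-elim (w≢r (depth≡0⇒root w lw≡0))

    level≡0-unique : ∀ {w w′} → level w ≡ 0 → level w′ ≡ 0 → w ≢ r → w′ ≢ r → w ≡ w′
    level≡0-unique {w} {w′} lw≡0 lw′≡0 w≢r w′≢r =
      trans (level≡0⇒c w lw≡0 w≢r) (≡.sym (level≡0⇒c w′ lw′≡0 w′≢r))

    level≢0⇒depth≢0 : ∀ w → level w ≢ 0 → depth w ≢ 0
    level≢0⇒depth≢0 w lw≢0 dw≡0 with inBranch? w
    ... | yes _ = lw≢0 (cong pred dw≡0)
    ... | no  _ = lw≢0 dw≡0

    level≡⇒depth≡ : ∀ w w′ → branch w ≡ branch w′ → depth w ≢ 0 → depth w′ ≢ 0 →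
                    level w ≡ level w′ → depth w ≡ depth w′
    level≡⇒depth≡ w w′ bw≡bw′ dw≢0 dw′≢0 with inBranch? w | inBranch? w′
    ... | yes _  | yes _   = pred-injective {{≢-nonZero dw≢0}} {{≢-nonZero dw′≢0}}
    ... | no  _  | no  _   = λ dw≡dw′ → dw≡dw′
    ... | yes w∈ | no  w′∉ = ⊥-elim (w′∉ (trans (≡.sym bw≡bw′) w∈))
    ... | no  w∉ | yes w′∈ = ⊥-elim (w∉ (trans bw≡bw′ w′∈))

    leaf : Fin n → Fin n
    leaf w = descend (suc (suc e)) w

    leaf-isLeaf : ∀ w → level w ≢ 0 → isLeaf G (leaf w) ≡ true
    leaf-isLeaf w lw≢0 with descend-ancestor (suc (suc e)) w
    ... | j , dℓ , _ = childless⇒leaf (leaf w)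
            (λ dℓ≡0 → level≢0⇒depth≢0 w lw≢0 (m+n≡0⇒n≡0 j (trans (≡.sym dℓ) dℓ≡0)))
            (descend-childless depth≤ (suc (suc e)) w (m≤n+m (suc (suc e)) (depth w)))

    leaf-injective : ∀ {w w′} → level w ≡ level w′ → level w ≢ 0 → leaf w ≡ leaf w′ → w ≡ w′
    leaf-injective {w} {w′} lw≡lw′ lw≢0 ℓ≡ℓ′
      with descend-ancestor (suc (suc e)) w | descend-ancestor (suc (suc e)) w′
    ... | j , dℓ , ℓ↑w | j′ , dℓ′ , ℓ′↑w′ = begin
      w                     ≡⟨ ≡.sym ℓ↑w ⟩
      ancestor j (leaf w)   ≡⟨ cong₂ ancestor j≡j′ ℓ≡ℓ′ ⟩
      ancestor j′ (leaf w′) ≡⟨ ℓ′↑w′ ⟩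
      w′                    ∎
      where
      open ≡-Reasoning
      dw≢0 : depth w ≢ 0
      dw≢0 = level≢0⇒depth≢0 w lw≢0
      dw′≢0 : depth w′ ≢ 0
      dw′≢0 = level≢0⇒depth≢0 w′ (λ lw′≡0 → lw≢0 (trans lw≡lw′ lw′≡0))
      same-branch : branch w ≡ branch w′
      same-branch = begin
        branch w         ≡⟨ ≡.sym (branch-ancestor (leaf w) j w dw≢0 dℓ ℓ↑w) ⟩
        branch (leaf w)  ≡⟨ cong branch ℓ≡ℓ′ ⟩
        branch (leaf w′) ≡⟨ branch-ancestor (leaf w′) j′ w′ dw′≢0 dℓ′ ℓ′↑w′ ⟩
        branch w′         ∎
      dw≡dw′ : depth w ≡ depth w′
      dw≡dw′ = level≡⇒depth≡ w w′ same-branch dw≢0 dw′≢0 lw≡lw′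
      j≡j′ : j ≡ j′
      j≡j′ = +-cancelʳ-≡ (depth w) j j′ (begin
        j + depth w     ≡⟨ ≡.sym dℓ ⟩
        depth (leaf w)  ≡⟨ cong depth ℓ≡ℓ′ ⟩
        depth (leaf w′) ≡⟨ dℓ′ ⟩
        j′ + depth w′   ≡⟨ cong (j′ +_) (≡.sym dw≡dw′) ⟩
        j′ + depth w    ∎)

    matching≤ : MatchingNumberAtMost G (b * t + 2)
    matching≤ =
      LevelCover.matching≤ G b t r level leaf level-adj level≤ level≡0-unique leaf-isLeaf leaf-injective leaves

  matching≤-from-centre : ∀ r → (∀ v → eccentricity r ≤ eccentricity v) → ∀ ε → eccentricity r ≡ ε →
                          MatchingNumberAtMost G (b * t + 2)
  matching≤-from-centre r _        zero    ecc≡0   =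
    edgeless⇒matching≤ G (eccentricity≡0⇒edgeless r ecc≡0) (b * t + 2)
  matching≤-from-centre r r-centre (suc e) ecc≡1+e =
    CentralEdge.matching≤ r r-centre e ecc≡1+e

lemma2p10 : (b t n : ℕ) → b ≥ 3 → (G : Graph n) → IsTree G →
    numLeaves G ≡ b → DiameterAtMost G (4 * t + 3) →
    MatchingNumberAtMost G (b * t + 2)
lemma2p10 b t zero    _ G _                     _      _         = edgeless⇒matching≤ G (λ { {()} }) (b * t + 2)
lemma2p10 b t (suc n) _ G (connected , acyclic) leaves diameter≤ =
  matching≤-from-centre G connected acyclic b t leaves diameter≤
    (centre Fin.zero) (centre-minimal Fin.zero) _ refl
  where open Eccentricity G connected acyclic using (centre; centre-minimal)
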